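{- For all finite types $\alpha,\beta,\gamma,\delta,\alpha_0,\alpha_1,\beta_0,\beta_1$: (i) if $\alpha$ is a strong retract of $\beta$ and $\beta$ of $\gamma$, then $\alpha$ is a strong retract of $\gamma$; (ii) if $\alpha_0$ is a strong retract of $\beta_0$ and $\alpha_1$ of $\beta_1$, then $\alpha_0\times\alpha_1$ is a strong retract of $\beta_0\times\beta_1$; (iii) if $\alpha$ is a strong retract of $\beta$, then $\gamma\to\alpha$ is a strong retract of $\gamma\to\beta$; (iv) if $\alpha$ is strongly isomorphic to $\beta$, then $\gamma\to\alpha$ is strongly isomorphic to $\gamma\to\beta$; (v) $(\alpha\to\beta)\times(\gamma\to\delta)$ is a strong retract of $\alpha\times\gamma\to\beta\times\delta$; (vi) $\alpha\to\beta\to\gamma$ is a strong retract of $\alpha\times\beta\to\gamma$.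
   Context: Finite types are generated by: $0$ is a type; if $\sigma,\tau$ are types, so are $\sigma\times\tau$ and $\sigma\to\tau$ ($\to$ associates to the right). $\mathsf{HA}^\omega$ is the many-sorted intuitionistic first-order theory whose sorts are the finite types. Its terms are built from variables and, for all types $\rho,\sigma,\tau$, the constants $\mathsf{k}:\rho\to\sigma\to\rho$, $\mathsf{s}:(\rho\to\sigma\to\tau)\to(\rho\to\sigma)\to(\rho\to\tau)$, $\mathsf{pair}:\sigma\to\tau\to\sigma\times\tau$, $\mathsf{fst}:\sigma\times\tau\to\sigma$, $\mathsf{snd}:\sigma\times\tau\to\tau$, $0:0$, $S:0\to0$, $\mathsf{R}:\sigma\to(0\to\sigma\to\sigma)\to0\to\sigma$, by application (associating to the left). Atomic formulas are $\bot$ and $s\equiv_\sigma t$. Axioms: $\equiv_\sigma$ is an equivalence relation; $x\equiv x'\to y\equiv y'\to xy\equiv x'y'$; $\mathsf{k}xy\equiv x$; $\mathsf{s}xyz\equiv xz(yz)$; $\mathsf{fst}(\mathsf{pair}\,xy)\equiv x$; $\mathsf{snd}(\mathsf{pair}\,xy)\equiv y$; $\mathsf{R}xy0\equiv x$; $\mathsf{R}xy(Sm)\equiv ym(\mathsf{R}xym)$; $Sx\equiv_0Sy\to x\equiv_0y$; $\neg(Sx\equiv_00)$; induction for all formulas. Surjective pairing is not assumed. $\mathsf{H}\text{ - }\mathsf{HA}^\omega$ extends the language with, for each type $\sigma$, a unary predicate $\mathrm{Ext}_\sigma$ and a binary predicate $=_\sigma$; $\forall^{\mathrm{Ext}}x:\sigma.\psi$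 abbreviates $\forall x:\sigma(\mathrm{Ext}_\sigma(x)\to\psi)$. Its axioms are those of $\mathsf{HA}^\omega$, induction for all formulas of the extended language, and for all $\sigma,\tau$: $x=_0y\leftrightarrow x\equiv_0y$; $\forall x:0\,\mathrm{Ext}_0(x)$; $x=_{\sigma\times\tau}y\leftrightarrow(\mathsf{fst}\,x=_\sigma\mathsf{fst}\,y\wedge\mathsf{snd}\,x=_\tau\mathsf{snd}\,y)$; $\mathrm{Ext}_{\sigma\times\tau}(x)\leftrightarrow(\mathrm{Ext}_\sigma(\mathsf{fst}\,x)\wedge\mathrm{Ext}_\tau(\mathsf{snd}\,x))$; $f=_{\sigma\to\tau}g\leftrightarrow\forall^{\mathrm{Ext}}x:\sigma.fx=_\tau gx$; $\mathrm{Ext}_{\sigma\to\tau}(f)\to\mathrm{Ext}_\sigma(x)\to\mathrm{Ext}_\tau(fx)$; $x\equiv_\sigma y\to\mathrm{Ext}_\sigma(x)\to\mathrm{Ext}_\sigma(y)$; $\mathrm{Ext}(c)$ for each constant $c$. A closed term $t:\alpha\to\beta$ is called strong if $\mathsf{H}\text{ - }\mathsf{HA}^\omega\vdash\forall x,y:\alpha(\mathrm{Ext}_\alpha(x)\to\mathrm{Ext}_\alpha(y)\to x=_\alpha y\to tx=_\beta ty)$. A type $\alpha$ is a strong retract of $\beta$ if there are strong closed terms $i:\alpha\to\beta$, $r:\beta\to\alpha$ with $\mathsf{H}\text{ - }\mathsf{HA}^\omega\vdash\forall^{\mathrm{Ext}}x:\alpha.\,r(ix)=_\alpha x$; $\alpha$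 and $\beta$ are strongly isomorphic if moreover $\mathsf{H}\text{ - }\mathsf{HA}^\omega\vdash\forall^{\mathrm{Ext}}y:\beta.\,i(ry)=_\beta y$. -}

module Defs where

-- Deep embedding of the many-sorted intuitionistic first-order theory
-- H-HA^omega (natural deduction), and the notions "strong term",
-- "strong retract", "strongly isomorphic".

open import Data.List using (List; []; _∷_; map)
open import Data.List.Membership.Propositional using (_∈_)
open import Data.Product using (Σ; _×_; _,_)

infixr 7 _⇒_
infixr 8 _⊗_

data Ty : Set where
  ι   : Ty
  _⊗_ : Ty → Ty → Ty
  _⇒_ : Ty → Ty → Ty

Ctx : Set
Ctx = List Ty

variable
  Γ Δ' : Ctx
  ρ σ τ : Ty

data _∋_ : Ctx → Ty → Set where
  here  : (σ ∷ Γ) ∋ σ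
  there : Γ ∋ σ → (τ ∷ Γ) ∋ σ

infixl 9 _·_

data Tm (Γ : Ctx) : Ty → Set where
  var  : Γ ∋ σ → Tm Γ σ
  K    : Tm Γ (ρ ⇒ σ ⇒ ρ)
  S    : Tm Γ ((ρ ⇒ σ ⇒ τ) ⇒ (ρ ⇒ σ) ⇒ ρ ⇒ τ)
  pair : Tm Γ (σ ⇒ τ ⇒ σ ⊗ τ)
  fst  : Tm Γ (σ ⊗ τ ⇒ σ)
  snd  : Tm Γ (σ ⊗ τ ⇒ τ)
  zero : Tm Γ ι
  suc  : Tm Γ (ι ⇒ ι)
  R    : Tm Γ (σ ⇒ (ι ⇒ σ ⇒ σ) ⇒ ι ⇒ σ)
  _·_  : Tm Γ (σ ⇒ τ) → Tm Γ σ → Tm Γ τ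

infix  6 _≣_ _≐_
infixr 5 _∧_
infixr 4 _∨_
infixr 3 _⊃_

data Fm (Γ : Ctx) : Set where
  ⊥'   : Fm Γ
  _≣_  : Tm Γ σ → Tm Γ σ → Fm Γ      -- intensional  s ≡_σ t
  _≐_  : Tm Γ σ → Tm Γ σ → Fm Γ      -- extensional  s =_σ t
  Ext  : Tm Γ σ → Fm Γ
  _∧_  : Fm Γ → Fm Γ → Fm Γ
  _∨_  : Fm Γ → Fm Γ → Fm Γ
  _⊃_  : Fm Γ → Fm Γ → Fm Γ
  All  : (σ : Ty) → Fm (σ ∷ Γ) → Fm Γ
  Ex   : (σ : Ty) → Fm (σ ∷ Γ) → Fm Γ

infix 2 _⇔_
_⇔_ : Fm Γ → Fm Γ → Fm Γ
φ ⇔ ψ = (φ ⊃ ψ) ∧ (ψ ⊃ φ)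

Ren : Ctx → Ctx → Set
Ren Γ Δ = ∀ {σ} → Γ ∋ σ → Δ ∋ σ

liftR : ∀ {Γ Δ} → Ren Γ Δ → Ren (τ ∷ Γ) (τ ∷ Δ)
liftR r here      = here
liftR r (there x) = there (r x)

renT : ∀ {Γ Δ} → Ren Γ Δ → Tm Γ σ → Tm Δ σ
renT r (var x) = var (r x)
renT r K       = K
renT r S       = S
renT r pair    = pair
renT r fst     = fst
renT r snd     = snd
renT r zero    = zero
renT r suc     = suc
renT r R       = R
renT r (t · u) = renT r t · renT r u

renF : ∀ {Γ Δ} → Ren Γ Δ → Fm Γ → Fm Δ
renF r ⊥'        = ⊥'
renF r (s ≣ t)   = renT r s ≣ renT r t
renF r (s ≐ t)   = renT r s ≐ renT r t
renF r (Ext t)   = Ext (renT r t)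
renF r (φ ∧ ψ)   = renF r φ ∧ renF r ψ
renF r (φ ∨ ψ)   = renF r φ ∨ renF r ψ
renF r (φ ⊃ ψ)   = renF r φ ⊃ renF r ψ
renF r (All σ φ) = All σ (renF (liftR r) φ)
renF r (Ex σ φ)  = Ex σ (renF (liftR r) φ)

wkT : Tm Γ σ → Tm (τ ∷ Γ) σ
wkT = renT there

wkF : Fm Γ → Fm (τ ∷ Γ)
wkF = renF there

Sub : Ctx → Ctx → Set
Sub Γ Δ = ∀ {σ} → Γ ∋ σ → Tm Δ σ

liftS : ∀ {Γ Δ} → Sub Γ Δ → Sub (τ ∷ Γ) (τ ∷ Δ)
liftS s here      = var here
liftS s (there x) = wkT (s x)

subT : ∀ {Γ Δ} → Sub Γ Δ → Tm Γ σ → Tm Δ σ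
subT s (var x) = s x
subT s K       = K
subT s S       = S
subT s pair    = pair
subT s fst     = fst
subT s snd     = snd
subT s zero    = zero
subT s suc     = suc
subT s R       = R
subT s (t · u) = subT s t · subT s u

subF : ∀ {Γ Δ} → Sub Γ Δ → Fm Γ → Fm Δ
subF s ⊥'        = ⊥'
subF s (a ≣ b)   = subT s a ≣ subT s b
subF s (a ≐ b)   = subT s a ≐ subT s b
subF s (Ext t)   = Ext (subT s t)
subF s (φ ∧ ψ)   = subF s φ ∧ subF s ψ
subF s (φ ∨ ψ)   = subF s φ ∨ subF s ψ
subF s (φ ⊃ ψ)   = subF s φ ⊃ subF s ψ
subF s (All σ φ) = All σ (subF (liftS s) φ)
subF s (Ex σ φ)  = Ex σ (subF (liftS s) φ)

sub1 : Tm Γ σ → Sub (σ ∷ Γ) Γ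
sub1 t here      = t
sub1 t (there x) = var x

_[_] : Fm (σ ∷ Γ) → Tm Γ σ → Fm Γ
φ [ t ] = subF (sub1 t) φ

subSuc : Sub (ι ∷ Γ) (ι ∷ Γ)
subSuc here      = suc · var here
subSuc (there x) = var (there x)

cl : Tm [] σ → Tm Γ σ
cl = renT (λ ())

x₀ : Tm (σ ∷ Γ) σ
x₀ = var here

x₁ : Tm (τ ∷ σ ∷ Γ) σ
x₁ = var (there here)

infix 1 _⊢_

data _⊢_ : {Γ : Ctx} → List (Fm Γ) → Fm Γ → Set where
  hyp  : ∀ {Γ} {H : List (Fm Γ)} {φ} → φ ∈ H → H ⊢ φ
  ⊥E   : ∀ {Γ} {H : List (Fm Γ)} {φ} → H ⊢ ⊥' → H ⊢ φ
  ∧I   : ∀ {Γ} {H : List (Fm Γ)} {φ ψ} → H ⊢ φ → H ⊢ ψ → H ⊢ φ ∧ ψ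
  ∧E₁  : ∀ {Γ} {H : List (Fm Γ)} {φ ψ} → H ⊢ φ ∧ ψ → H ⊢ φ
  ∧E₂  : ∀ {Γ} {H : List (Fm Γ)} {φ ψ} → H ⊢ φ ∧ ψ → H ⊢ ψ
  ∨I₁  : ∀ {Γ} {H : List (Fm Γ)} {φ ψ} → H ⊢ φ → H ⊢ φ ∨ ψ
  ∨I₂  : ∀ {Γ} {H : List (Fm Γ)} {φ ψ} → H ⊢ ψ → H ⊢ φ ∨ ψ
  ∨E   : ∀ {Γ} {H : List (Fm Γ)} {φ ψ χ} → H ⊢ φ ∨ ψ →
         (φ ∷ H) ⊢ χ → (ψ ∷ H) ⊢ χ → H ⊢ χ
  ⊃I   : ∀ {Γ} {H : List (Fm Γ)} {φ ψ} → (φ ∷ H) ⊢ ψ → H ⊢ φ ⊃ ψ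
  ⊃E   : ∀ {Γ} {H : List (Fm Γ)} {φ ψ} → H ⊢ φ ⊃ ψ → H ⊢ φ → H ⊢ ψ
  ∀I   : ∀ {Γ} {H : List (Fm Γ)} {σ} {φ : Fm (σ ∷ Γ)} →
         map wkF H ⊢ φ → H ⊢ All σ φ
  ∀E   : ∀ {Γ} {H : List (Fm Γ)} {σ} {φ : Fm (σ ∷ Γ)} →
         H ⊢ All σ φ → (t : Tm Γ σ) → H ⊢ φ [ t ]
  ∃I   : ∀ {Γ} {H : List (Fm Γ)} {σ} {φ : Fm (σ ∷ Γ)} →
         (t : Tm Γ σ) → H ⊢ φ [ t ] → H ⊢ Ex σ φ
  ∃E   : ∀ {Γ} {H : List (Fm Γ)} {σ} {φ : Fm (σ ∷ Γ)} {ψ} →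
         H ⊢ Ex σ φ → (φ ∷ map wkF H) ⊢ wkF ψ → H ⊢ ψ
  ≣-refl  : ∀ {Γ} {H : List (Fm Γ)} {σ} (x : Tm Γ σ) → H ⊢ x ≣ x
  ≣-sym   : ∀ {Γ} {H : List (Fm Γ)} {σ} (x y : Tm Γ σ) → H ⊢ x ≣ y ⊃ y ≣ x
  ≣-trans : ∀ {Γ} {H : List (Fm Γ)} {σ} (x y z : Tm Γ σ) →
            H ⊢ x ≣ y ⊃ y ≣ z ⊃ x ≣ z
  ≣-app   : ∀ {Γ} {H : List (Fm Γ)} {σ τ} (x x' : Tm Γ (σ ⇒ τ)) (y y' : Tm Γ σ) →
            H ⊢ x ≣ x' ⊃ y ≣ y' ⊃ x · y ≣ x' · y'
  ax-K    : ∀ {Γ} {H : List (Fm Γ)} {ρ σ} (x : Tm Γ ρ) (y : Tm Γ σ) →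
            H ⊢ K · x · y ≣ x
  ax-S    : ∀ {Γ} {H : List (Fm Γ)} {ρ σ τ}
            (x : Tm Γ (ρ ⇒ σ ⇒ τ)) (y : Tm Γ (ρ ⇒ σ)) (z : Tm Γ ρ) →
            H ⊢ S · x · y · z ≣ x · z · (y · z)
  ax-fst  : ∀ {Γ} {H : List (Fm Γ)} {σ τ} (x : Tm Γ σ) (y : Tm Γ τ) →
            H ⊢ fst · (pair · x · y) ≣ x
  ax-snd  : ∀ {Γ} {H : List (Fm Γ)} {σ τ} (x : Tm Γ σ) (y : Tm Γ τ) →
            H ⊢ snd · (pair · x · y) ≣ y
  ax-R0   : ∀ {Γ} {H : List (Fm Γ)} {σ} (x : Tm Γ σ) (y : Tm Γ (ι ⇒ σ ⇒ σ)) →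
            H ⊢ R · x · y · zero ≣ x
  ax-RS   : ∀ {Γ} {H : List (Fm Γ)} {σ} (x : Tm Γ σ) (y : Tm Γ (ι ⇒ σ ⇒ σ))
            (m : Tm Γ ι) →
            H ⊢ R · x · y · (suc · m) ≣ y · m · (R · x · y · m)
  ax-Sinj : ∀ {Γ} {H : List (Fm Γ)} (x y : Tm Γ ι) →
            H ⊢ suc · x ≣ suc · y ⊃ x ≣ y
  ax-S≠0  : ∀ {Γ} {H : List (Fm Γ)} (x : Tm Γ ι) →
            H ⊢ suc · x ≣ zero ⊃ ⊥'
  -- induction for all formulas of the extended language
  ax-ind  : ∀ {Γ} {H : List (Fm Γ)} (φ : Fm (ι ∷ Γ)) →
            H ⊢ φ [ zero ] ⊃ All ι (φ ⊃ subF subSuc φ) ⊃ All ι φ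
  ax-=0   : ∀ {Γ} {H : List (Fm Γ)} (x y : Tm Γ ι) → H ⊢ (x ≐ y) ⇔ (x ≣ y)
  ax-Ext0 : ∀ {Γ} {H : List (Fm Γ)} (x : Tm Γ ι) → H ⊢ Ext x
  ax-=×   : ∀ {Γ} {H : List (Fm Γ)} {σ τ} (x y : Tm Γ (σ ⊗ τ)) →
            H ⊢ (x ≐ y) ⇔ (fst · x ≐ fst · y ∧ snd · x ≐ snd · y)
  ax-Ext× : ∀ {Γ} {H : List (Fm Γ)} {σ τ} (x : Tm Γ (σ ⊗ τ)) →
            H ⊢ Ext x ⇔ (Ext (fst · x) ∧ Ext (snd · x))
  ax-=⇒   : ∀ {Γ} {H : List (Fm Γ)} {σ τ} (f g : Tm Γ (σ ⇒ τ)) →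
            H ⊢ (f ≐ g) ⇔ All σ (Ext x₀ ⊃ wkT f · x₀ ≐ wkT g · x₀)
  ax-Ext⇒ : ∀ {Γ} {H : List (Fm Γ)} {σ τ} (f : Tm Γ (σ ⇒ τ)) (x : Tm Γ σ) →
            H ⊢ Ext f ⊃ Ext x ⊃ Ext (f · x)
  ax-Ext≣ : ∀ {Γ} {H : List (Fm Γ)} {σ} (x y : Tm Γ σ) →
            H ⊢ x ≣ y ⊃ Ext x ⊃ Ext y
  ext-K    : ∀ {Γ} {H : List (Fm Γ)} {ρ σ} → H ⊢ Ext {σ = ρ ⇒ σ ⇒ ρ} K
  ext-S    : ∀ {Γ} {H : List (Fm Γ)} {ρ σ τ} →
             H ⊢ Ext {σ = (ρ ⇒ σ ⇒ τ) ⇒ (ρ ⇒ σ) ⇒ ρ ⇒ τ} S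
  ext-pair : ∀ {Γ} {H : List (Fm Γ)} {σ τ} → H ⊢ Ext {σ = σ ⇒ τ ⇒ σ ⊗ τ} pair
  ext-fst  : ∀ {Γ} {H : List (Fm Γ)} {σ τ} → H ⊢ Ext {σ = σ ⊗ τ ⇒ σ} fst
  ext-snd  : ∀ {Γ} {H : List (Fm Γ)} {σ τ} → H ⊢ Ext {σ = σ ⊗ τ ⇒ τ} snd
  ext-0    : ∀ {Γ} {H : List (Fm Γ)} → H ⊢ Ext {σ = ι} zero
  ext-suc  : ∀ {Γ} {H : List (Fm Γ)} → H ⊢ Ext {σ = ι ⇒ ι} suc
  ext-R    : ∀ {Γ} {H : List (Fm Γ)} {σ} →
             H ⊢ Ext {σ = σ ⇒ (ι ⇒ σ ⇒ σ) ⇒ ι ⇒ σ} R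

HHA⊢ : Fm [] → Set
HHA⊢ φ = [] ⊢ φ

Strong : ∀ {α β} → Tm [] (α ⇒ β) → Set
Strong {α} {β} t =
  HHA⊢ (All α (All α (Ext x₁ ⊃ Ext x₀ ⊃ x₁ ≐ x₀ ⊃ cl t · x₁ ≐ cl t · x₀)))

LeftInv : ∀ {α β} → Tm [] (α ⇒ β) → Tm [] (β ⇒ α) → Set
LeftInv {α} i r = HHA⊢ (All α (Ext x₀ ⊃ cl r · (cl i · x₀) ≐ x₀))

StrongRetract : Ty → Ty → Set
StrongRetract α β =
  Σ (Tm [] (α ⇒ β)) λ i → Σ (Tm [] (β ⇒ α)) λ r →
    Strong i × Strong r × LeftInv i r

StrongIso : Ty → Ty → Set
StrongIso α β =
  Σ (Tm [] (α ⇒ β)) λ i → Σ (Tm [] (β ⇒ α)) λ r →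
    Strong i × Strong r × LeftInv i r × LeftInv r i

{-# OPTIONS --safe #-}
-- Each embedding and retraction is an explicit combinator built by bracket abstraction:
-- composition, the componentwise map on products, pairing and splitting of functions
-- (splitting fills the missing argument with a closed, hence extensional, inhabitant),
-- and currying.  Strongness and the left-inverse equations then follow from the β-laws
-- of these combinators, the defining axioms of = and Ext, and the fact that ≡ implies =
-- at every type.  For (i) the outer retraction must be strong, so that the inner
-- left-inverse equation can be pushed through it.
module Submission where

open import Defs
open import Data.Product using (_×_; _,_)
open import Data.List using (List; []; _∷_; map)
open import Data.List.Membership.Propositional using (_∈_)
open import Data.List.Membership.Propositional.Properties using (∈-map⁺; ∈-map⁻)
open import Data.List.Relation.Unary.Any using (here; there)
open import Relation.Binary.PropositionalEquality
  using (_≡_; refl; sym; trans; cong; cong₂; subst; subst₂)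

-- Substitution and renaming

liftR-cong : ∀ {Γ Δ τ} {r r′ : Ren Γ Δ} → (∀ {ρ} (x : Γ ∋ ρ) → r x ≡ r′ x) →
             ∀ {ρ} (x : (τ ∷ Γ) ∋ ρ) → liftR r x ≡ liftR r′ x
liftR-cong e here      = refl
liftR-cong e (there x) = cong there (e x)

renT-cong : ∀ {Γ Δ σ} {r r′ : Ren Γ Δ} → (∀ {ρ} (x : Γ ∋ ρ) → r x ≡ r′ x) →
            (t : Tm Γ σ) → renT r t ≡ renT r′ t
renT-cong e (var x) = cong var (e x)
renT-cong e (t · u) = cong₂ _·_ (renT-cong e t) (renT-cong e u)
renT-cong e K       = refl
renT-cong e S       = refl
renT-cong e pair    = refl
renT-cong e fst     = refl
renT-cong e snd     = refl
renT-cong e zero    = refl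
renT-cong e suc     = refl
renT-cong e R       = refl

renF-cong : ∀ {Γ Δ} {r r′ : Ren Γ Δ} → (∀ {ρ} (x : Γ ∋ ρ) → r x ≡ r′ x) →
            (φ : Fm Γ) → renF r φ ≡ renF r′ φ
renF-cong e ⊥'        = refl
renF-cong e (a ≣ b)   = cong₂ _≣_ (renT-cong e a) (renT-cong e b)
renF-cong e (a ≐ b)   = cong₂ _≐_ (renT-cong e a) (renT-cong e b)
renF-cong e (Ext a)   = cong Ext (renT-cong e a)
renF-cong e (φ ∧ ψ)   = cong₂ _∧_ (renF-cong e φ) (renF-cong e ψ)
renF-cong e (φ ∨ ψ)   = cong₂ _∨_ (renF-cong e φ) (renF-cong e ψ)
renF-cong e (φ ⊃ ψ)   = cong₂ _⊃_ (renF-cong e φ) (renF-cong e ψ)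
renF-cong e (All σ φ) = cong (All σ) (renF-cong (liftR-cong e) φ)
renF-cong e (Ex σ φ)  = cong (Ex σ) (renF-cong (liftR-cong e) φ)

liftS-cong : ∀ {Γ Δ τ} {s s′ : Sub Γ Δ} → (∀ {ρ} (x : Γ ∋ ρ) → s x ≡ s′ x) →
             ∀ {ρ} (x : (τ ∷ Γ) ∋ ρ) → liftS s x ≡ liftS s′ x
liftS-cong e here      = refl
liftS-cong e (there x) = cong wkT (e x)

subT-cong : ∀ {Γ Δ σ} {s s′ : Sub Γ Δ} → (∀ {ρ} (x : Γ ∋ ρ) → s x ≡ s′ x) →
            (t : Tm Γ σ) → subT s t ≡ subT s′ t
subT-cong e (var x) = e x
subT-cong e (t · u) = cong₂ _·_ (subT-cong e t) (subT-cong e u)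
subT-cong e K       = refl
subT-cong e S       = refl
subT-cong e pair    = refl
subT-cong e fst     = refl
subT-cong e snd     = refl
subT-cong e zero    = refl
subT-cong e suc     = refl
subT-cong e R       = refl

subF-cong : ∀ {Γ Δ} {s s′ : Sub Γ Δ} → (∀ {ρ} (x : Γ ∋ ρ) → s x ≡ s′ x) →
            (φ : Fm Γ) → subF s φ ≡ subF s′ φ
subF-cong e ⊥'        = refl
subF-cong e (a ≣ b)   = cong₂ _≣_ (subT-cong e a) (subT-cong e b)
subF-cong e (a ≐ b)   = cong₂ _≐_ (subT-cong e a) (subT-cong e b)
subF-cong e (Ext a)   = cong Ext (subT-cong e a)
subF-cong e (φ ∧ ψ)   = cong₂ _∧_ (subF-cong e φ) (subF-cong e ψ)
subF-cong e (φ ∨ ψ)   = cong₂ _∨_ (subF-cong e φ) (subF-cong e ψ)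
subF-cong e (φ ⊃ ψ)   = cong₂ _⊃_ (subF-cong e φ) (subF-cong e ψ)
subF-cong e (All σ φ) = cong (All σ) (subF-cong (liftS-cong e) φ)
subF-cong e (Ex σ φ)  = cong (Ex σ) (subF-cong (liftS-cong e) φ)

renT-∘ : ∀ {Γ Δ Θ σ} (r : Ren Γ Δ) (r′ : Ren Δ Θ) (t : Tm Γ σ) →
         renT r′ (renT r t) ≡ renT (λ x → r′ (r x)) t
renT-∘ r r′ (var x) = refl
renT-∘ r r′ (t · u) = cong₂ _·_ (renT-∘ r r′ t) (renT-∘ r r′ u)
renT-∘ r r′ K       = refl
renT-∘ r r′ S       = refl
renT-∘ r r′ pair    = refl
renT-∘ r r′ fst     = refl
renT-∘ r r′ snd     = refl
renT-∘ r r′ zero    = refl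
renT-∘ r r′ suc     = refl
renT-∘ r r′ R       = refl

renF-∘ : ∀ {Γ Δ Θ} (r : Ren Γ Δ) (r′ : Ren Δ Θ) (φ : Fm Γ) →
         renF r′ (renF r φ) ≡ renF (λ x → r′ (r x)) φ
renF-∘ r r′ ⊥'        = refl
renF-∘ r r′ (a ≣ b)   = cong₂ _≣_ (renT-∘ r r′ a) (renT-∘ r r′ b)
renF-∘ r r′ (a ≐ b)   = cong₂ _≐_ (renT-∘ r r′ a) (renT-∘ r r′ b)
renF-∘ r r′ (Ext a)   = cong Ext (renT-∘ r r′ a)
renF-∘ r r′ (φ ∧ ψ)   = cong₂ _∧_ (renF-∘ r r′ φ) (renF-∘ r r′ ψ)
renF-∘ r r′ (φ ∨ ψ)   = cong₂ _∨_ (renF-∘ r r′ φ) (renF-∘ r r′ ψ)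
renF-∘ r r′ (φ ⊃ ψ)   = cong₂ _⊃_ (renF-∘ r r′ φ) (renF-∘ r r′ ψ)
renF-∘ r r′ (All σ φ) =
  cong (All σ) (trans (renF-∘ (liftR r) (liftR r′) φ) (renF-cong (λ { here → refl ; (there x) → refl }) φ))
renF-∘ r r′ (Ex σ φ)  =
  cong (Ex σ) (trans (renF-∘ (liftR r) (liftR r′) φ) (renF-cong (λ { here → refl ; (there x) → refl }) φ))

renT-subT : ∀ {Γ Δ Θ σ} (s : Sub Γ Δ) (r : Ren Δ Θ) (t : Tm Γ σ) →
            renT r (subT s t) ≡ subT (λ x → renT r (s x)) t
renT-subT s r (var x) = refl
renT-subT s r (t · u) = cong₂ _·_ (renT-subT s r t) (renT-subT s r u)
renT-subT s r K       = refl
renT-subT s r S       = refl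
renT-subT s r pair    = refl
renT-subT s r fst     = refl
renT-subT s r snd     = refl
renT-subT s r zero    = refl
renT-subT s r suc     = refl
renT-subT s r R       = refl

renT-liftS : ∀ {Γ Δ Θ τ} (s : Sub Γ Δ) (r : Ren Δ Θ) → ∀ {ρ} (x : (τ ∷ Γ) ∋ ρ) →
             renT (liftR r) (liftS s x) ≡ liftS (λ y → renT r (s y)) x
renT-liftS s r here      = refl
renT-liftS s r (there x) = trans (renT-∘ there (liftR r) (s x)) (sym (renT-∘ r there (s x)))

renF-subF : ∀ {Γ Δ Θ} (s : Sub Γ Δ) (r : Ren Δ Θ) (φ : Fm Γ) →
            renF r (subF s φ) ≡ subF (λ x → renT r (s x)) φ
renF-subF s r ⊥'        = refl
renF-subF s r (a ≣ b)   = cong₂ _≣_ (renT-subT s r a) (renT-subT s r b)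
renF-subF s r (a ≐ b)   = cong₂ _≐_ (renT-subT s r a) (renT-subT s r b)
renF-subF s r (Ext a)   = cong Ext (renT-subT s r a)
renF-subF s r (φ ∧ ψ)   = cong₂ _∧_ (renF-subF s r φ) (renF-subF s r ψ)
renF-subF s r (φ ∨ ψ)   = cong₂ _∨_ (renF-subF s r φ) (renF-subF s r ψ)
renF-subF s r (φ ⊃ ψ)   = cong₂ _⊃_ (renF-subF s r φ) (renF-subF s r ψ)
renF-subF s r (All σ φ) =
  cong (All σ) (trans (renF-subF (liftS s) (liftR r) φ) (subF-cong (renT-liftS s r) φ))
renF-subF s r (Ex σ φ)  =
  cong (Ex σ) (trans (renF-subF (liftS s) (liftR r) φ) (subF-cong (renT-liftS s r) φ))

subT-renT : ∀ {Γ Δ Θ σ} (r : Ren Γ Δ) (s : Sub Δ Θ) (t : Tm Γ σ) →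
            subT s (renT r t) ≡ subT (λ x → s (r x)) t
subT-renT r s (var x) = refl
subT-renT r s (t · u) = cong₂ _·_ (subT-renT r s t) (subT-renT r s u)
subT-renT r s K       = refl
subT-renT r s S       = refl
subT-renT r s pair    = refl
subT-renT r s fst     = refl
subT-renT r s snd     = refl
subT-renT r s zero    = refl
subT-renT r s suc     = refl
subT-renT r s R       = refl

subF-renF : ∀ {Γ Δ Θ} (r : Ren Γ Δ) (s : Sub Δ Θ) (φ : Fm Γ) →
            subF s (renF r φ) ≡ subF (λ x → s (r x)) φ
subF-renF r s ⊥'        = refl
subF-renF r s (a ≣ b)   = cong₂ _≣_ (subT-renT r s a) (subT-renT r s b)
subF-renF r s (a ≐ b)   = cong₂ _≐_ (subT-renT r s a) (subT-renT r s b)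
subF-renF r s (Ext a)   = cong Ext (subT-renT r s a)
subF-renF r s (φ ∧ ψ)   = cong₂ _∧_ (subF-renF r s φ) (subF-renF r s ψ)
subF-renF r s (φ ∨ ψ)   = cong₂ _∨_ (subF-renF r s φ) (subF-renF r s ψ)
subF-renF r s (φ ⊃ ψ)   = cong₂ _⊃_ (subF-renF r s φ) (subF-renF r s ψ)
subF-renF r s (All σ φ) =
  cong (All σ) (trans (subF-renF (liftR r) (liftS s) φ) (subF-cong (λ { here → refl ; (there x) → refl }) φ))
subF-renF r s (Ex σ φ)  =
  cong (Ex σ) (trans (subF-renF (liftR r) (liftS s) φ) (subF-cong (λ { here → refl ; (there x) → refl }) φ))

subT-var : ∀ {Γ σ} (t : Tm Γ σ) → subT var t ≡ t
subT-var (var x) = refl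
subT-var (t · u) = cong₂ _·_ (subT-var t) (subT-var u)
subT-var K       = refl
subT-var S       = refl
subT-var pair    = refl
subT-var fst     = refl
subT-var snd     = refl
subT-var zero    = refl
subT-var suc     = refl
subT-var R       = refl

renT-id : ∀ {Γ σ} (t : Tm Γ σ) → renT (λ x → x) t ≡ t
renT-id (var x) = refl
renT-id (t · u) = cong₂ _·_ (renT-id t) (renT-id u)
renT-id K       = refl
renT-id S       = refl
renT-id pair    = refl
renT-id fst     = refl
renT-id snd     = refl
renT-id zero    = refl
renT-id suc     = refl
renT-id R       = refl

renF-id : ∀ {Γ} (φ : Fm Γ) → renF (λ x → x) φ ≡ φ
renF-id ⊥'        = refl
renF-id (a ≣ b)   = cong₂ _≣_ (renT-id a) (renT-id b)
renF-id (a ≐ b)   = cong₂ _≐_ (renT-id a) (renT-id b)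
renF-id (Ext a)   = cong Ext (renT-id a)
renF-id (φ ∧ ψ)   = cong₂ _∧_ (renF-id φ) (renF-id ψ)
renF-id (φ ∨ ψ)   = cong₂ _∨_ (renF-id φ) (renF-id ψ)
renF-id (φ ⊃ ψ)   = cong₂ _⊃_ (renF-id φ) (renF-id ψ)
renF-id (All σ φ) = cong (All σ) (trans (renF-cong (λ { here → refl ; (there x) → refl }) φ) (renF-id φ))
renF-id (Ex σ φ)  = cong (Ex σ) (trans (renF-cong (λ { here → refl ; (there x) → refl }) φ) (renF-id φ))

renF-[] : ∀ {Γ Δ σ} (r : Ren Γ Δ) (φ : Fm (σ ∷ Γ)) (t : Tm Γ σ) →
          renF r (φ [ t ]) ≡ renF (liftR r) φ [ renT r t ]
renF-[] r φ t = trans (renF-subF (sub1 t) r φ)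
  (trans (subF-cong (λ { here → refl ; (there x) → refl }) φ) (sym (subF-renF (liftR r) (sub1 (renT r t)) φ)))

renF-subSuc : ∀ {Γ Δ} (r : Ren Γ Δ) (φ : Fm (ι ∷ Γ)) →
              renF (liftR r) (subF subSuc φ) ≡ subF subSuc (renF (liftR r) φ)
renF-subSuc r φ = trans (renF-subF subSuc (liftR r) φ)
  (trans (subF-cong (λ { here → refl ; (there x) → refl }) φ) (sym (subF-renF (liftR r) subSuc φ)))

renT-wkT : ∀ {Γ Δ τ σ} (r : Ren Γ Δ) (t : Tm Γ σ) → renT (liftR {τ = τ} r) (wkT t) ≡ wkT (renT r t)
renT-wkT r t = trans (renT-∘ there (liftR r) t) (sym (renT-∘ r there t))

renF-wkF : ∀ {Γ Δ τ} (r : Ren Γ Δ) (φ : Fm Γ) → renF (liftR {τ = τ} r) (wkF φ) ≡ wkF (renF r φ)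
renF-wkF r φ = trans (renF-∘ there (liftR r) φ) (sym (renF-∘ r there φ))

sub1-wkT : ∀ {Γ σ τ} (a : Tm Γ σ) (t : Tm Γ τ) → subT (sub1 a) (wkT t) ≡ t
sub1-wkT a t = trans (subT-renT there (sub1 a) t) (subT-var t)

renT-cl : ∀ {Γ Δ σ} (r : Ren Γ Δ) (t : Tm [] σ) → renT r (cl t) ≡ cl t
renT-cl r t = trans (renT-∘ _ r t) (renT-cong (λ ()) t)

cl≡subT : ∀ {Γ σ} (s : Sub [] Γ) (t : Tm [] σ) → cl t ≡ subT s t
cl≡subT s t = trans (sym (subT-var (cl t))) (trans (subT-renT _ var t) (subT-cong (λ ()) t))

subT-cl : ∀ {Γ Δ σ} (s : Sub Γ Δ) (t : Tm [] σ) → subT s (cl t) ≡ cl t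
subT-cl s t = trans (subT-renT _ s t) (sym (cl≡subT _ t))

wkT-cl : ∀ {Γ σ τ} (t : Tm [] σ) → wkT {τ = τ} (cl {Γ = Γ} t) ≡ cl t
wkT-cl = renT-cl there

wkT-cl-app : ∀ {Γ σ τ ρ} (c : Tm [] (σ ⇒ ρ)) (t : Tm Γ σ) → wkT {τ = τ} (cl c · t) ≡ cl c · wkT t
wkT-cl-app c t = cong (_· wkT t) (wkT-cl c)

subT-renT-cl : ∀ {Γ Δ Θ σ} (s : Sub Δ Θ) (r : Ren Γ Δ) (t : Tm [] σ) → subT s (renT r (cl t)) ≡ cl t
subT-renT-cl s r t = trans (cong (subT s) (renT-cl r t)) (subT-cl s t)

-- Renaming derivations

RenHyps : ∀ {Γ Δ} → Ren Γ Δ → List (Fm Γ) → List (Fm Δ) → Set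
RenHyps r H H′ = ∀ {ψ} → ψ ∈ H → renF r ψ ∈ H′

RenHyps-∷ : ∀ {Γ Δ} {r : Ren Γ Δ} {H H′ φ} → RenHyps r H H′ → RenHyps r (φ ∷ H) (renF r φ ∷ H′)
RenHyps-∷ c (here refl) = here refl
RenHyps-∷ c (there m)   = there (c m)

RenHyps-lift : ∀ {Γ Δ τ} {r : Ren Γ Δ} {H H′} → RenHyps r H H′ →
               RenHyps (liftR {τ = τ} r) (map wkF H) (map wkF H′)
RenHyps-lift {r = r} {H′ = H′} c m with ∈-map⁻ wkF m
... | ψ , ψ∈H , refl = subst (_∈ map wkF H′) (sym (renF-wkF r ψ)) (∈-map⁺ wkF (c ψ∈H))

ren⊢ : ∀ {Γ Δ} {H : List (Fm Γ)} {H′ : List (Fm Δ)} {φ} (r : Ren Γ Δ) →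
       RenHyps r H H′ → H ⊢ φ → H′ ⊢ renF r φ
ren⊢ r c (hyp m)      = hyp (c m)
ren⊢ r c (⊥E d)       = ⊥E (ren⊢ r c d)
ren⊢ r c (∧I d e)     = ∧I (ren⊢ r c d) (ren⊢ r c e)
ren⊢ r c (∧E₁ d)      = ∧E₁ (ren⊢ r c d)
ren⊢ r c (∧E₂ d)      = ∧E₂ (ren⊢ r c d)
ren⊢ r c (∨I₁ d)      = ∨I₁ (ren⊢ r c d)
ren⊢ r c (∨I₂ d)      = ∨I₂ (ren⊢ r c d)
ren⊢ r c (∨E d e f)   = ∨E (ren⊢ r c d) (ren⊢ r (RenHyps-∷ c) e) (ren⊢ r (RenHyps-∷ c) f)
ren⊢ r c (⊃I d)       = ⊃I (ren⊢ r (RenHyps-∷ c) d)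
ren⊢ r c (⊃E d e)     = ⊃E (ren⊢ r c d) (ren⊢ r c e)
ren⊢ r c (∀I d)       = ∀I (ren⊢ (liftR r) (RenHyps-lift c) d)
ren⊢ r c (∀E {φ = φ} d t) =
  subst (_ ⊢_) (sym (renF-[] r φ t)) (∀E (ren⊢ r c d) (renT r t))
ren⊢ r c (∃I {φ = φ} t d) =
  ∃I (renT r t) (subst (_ ⊢_) (renF-[] r φ t) (ren⊢ r c d))
ren⊢ r c (∃E {ψ = ψ} d e) =
  ∃E (ren⊢ r c d) (subst (_ ⊢_) (renF-wkF r ψ) (ren⊢ (liftR r) (RenHyps-∷ (RenHyps-lift c)) e))
ren⊢ r c (≣-refl x)         = ≣-refl (renT r x)
ren⊢ r c (≣-sym x y)        = ≣-sym (renT r x) (renT r y)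
ren⊢ r c (≣-trans x y z)    = ≣-trans (renT r x) (renT r y) (renT r z)
ren⊢ r c (≣-app x x′ y y′)  = ≣-app (renT r x) (renT r x′) (renT r y) (renT r y′)
ren⊢ r c (ax-K x y)         = ax-K (renT r x) (renT r y)
ren⊢ r c (ax-S x y z)       = ax-S (renT r x) (renT r y) (renT r z)
ren⊢ r c (ax-fst x y)       = ax-fst (renT r x) (renT r y)
ren⊢ r c (ax-snd x y)       = ax-snd (renT r x) (renT r y)
ren⊢ r c (ax-R0 x y)        = ax-R0 (renT r x) (renT r y)
ren⊢ r c (ax-RS x y m)      = ax-RS (renT r x) (renT r y) (renT r m)
ren⊢ r c (ax-Sinj x y)      = ax-Sinj (renT r x) (renT r y)
ren⊢ r c (ax-S≠0 x)         = ax-S≠0 (renT r x)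
ren⊢ {H′ = H′} r c (ax-ind φ) =
  subst₂ (λ A B → H′ ⊢ A ⊃ All ι (renF (liftR r) φ ⊃ B) ⊃ All ι (renF (liftR r) φ))
    (sym (renF-[] r φ zero)) (sym (renF-subSuc r φ)) (ax-ind (renF (liftR r) φ))
ren⊢ r c (ax-=0 x y)        = ax-=0 (renT r x) (renT r y)
ren⊢ r c (ax-Ext0 x)        = ax-Ext0 (renT r x)
ren⊢ r c (ax-=× x y)        = ax-=× (renT r x) (renT r y)
ren⊢ r c (ax-Ext× x)        = ax-Ext× (renT r x)
ren⊢ {H′ = H′} r c (ax-=⇒ f g) =
  subst₂ (λ A B → H′ ⊢ (renT r f ≐ renT r g) ⇔ All _ (Ext x₀ ⊃ A · x₀ ≐ B · x₀))
    (sym (renT-wkT r f)) (sym (renT-wkT r g)) (ax-=⇒ (renT r f) (renT r g))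
ren⊢ r c (ax-Ext⇒ f x)      = ax-Ext⇒ (renT r f) (renT r x)
ren⊢ r c (ax-Ext≣ x y)      = ax-Ext≣ (renT r x) (renT r y)
ren⊢ r c ext-K              = ext-K
ren⊢ r c ext-S              = ext-S
ren⊢ r c ext-pair           = ext-pair
ren⊢ r c ext-fst            = ext-fst
ren⊢ r c ext-snd            = ext-snd
ren⊢ r c ext-0              = ext-0
ren⊢ r c ext-suc            = ext-suc
ren⊢ r c ext-R              = ext-R

⊢-mono : ∀ {Γ} {H H′ : List (Fm Γ)} {φ} → (∀ {ψ} → ψ ∈ H → ψ ∈ H′) → H ⊢ φ → H′ ⊢ φ
⊢-mono {H′ = H′} {φ} c d =
  subst (H′ ⊢_) (renF-id φ) (ren⊢ (λ x → x) (λ {ψ} m → subst (_∈ H′) (sym (renF-id ψ)) (c m)) d)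

⊢-wkExt : ∀ {Γ τ} {H : List (Fm Γ)} {φ} → H ⊢ φ → (Ext {σ = τ} x₀ ∷ map wkF H) ⊢ wkF φ
⊢-wkExt d = ⊢-mono there (ren⊢ there (∈-map⁺ wkF) d)

ren∅ : ∀ {Γ} → Ren [] Γ
ren∅ ()

⊢-closed : ∀ {Γ} {H : List (Fm Γ)} {φ} → [] ⊢ φ → H ⊢ renF ren∅ φ
⊢-closed d = ren⊢ ren∅ (λ ()) d

-- Derived rules of H-HA^ω

⊢≣-refl : ∀ {Γ} {H : List (Fm Γ)} {σ} {a : Tm Γ σ} → H ⊢ a ≣ a
⊢≣-refl = ≣-refl _

⊢≣-sym : ∀ {Γ} {H : List (Fm Γ)} {σ} {a b : Tm Γ σ} → H ⊢ a ≣ b → H ⊢ b ≣ a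
⊢≣-sym d = ⊃E (≣-sym _ _) d

⊢≣-trans : ∀ {Γ} {H : List (Fm Γ)} {σ} {a b c : Tm Γ σ} → H ⊢ a ≣ b → H ⊢ b ≣ c → H ⊢ a ≣ c
⊢≣-trans d e = ⊃E (⊃E (≣-trans _ _ _) d) e

⊢≣-cong : ∀ {Γ} {H : List (Fm Γ)} {σ τ} {f f′ : Tm Γ (σ ⇒ τ)} {a a′ : Tm Γ σ} →
          H ⊢ f ≣ f′ → H ⊢ a ≣ a′ → H ⊢ f · a ≣ f′ · a′
⊢≣-cong d e = ⊃E (⊃E (≣-app _ _ _ _) d) e

⊢≣-congʳ : ∀ {Γ} {H : List (Fm Γ)} {σ τ} {f : Tm Γ (σ ⇒ τ)} {a a′ : Tm Γ σ} →
           H ⊢ a ≣ a′ → H ⊢ f · a ≣ f · a′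
⊢≣-congʳ = ⊢≣-cong ⊢≣-refl

⊢≣-congˡ : ∀ {Γ} {H : List (Fm Γ)} {σ τ} {f f′ : Tm Γ (σ ⇒ τ)} {a : Tm Γ σ} →
           H ⊢ f ≣ f′ → H ⊢ f · a ≣ f′ · a
⊢≣-congˡ d = ⊢≣-cong d ⊢≣-refl

⊢≐-ext : ∀ {Γ} {H : List (Fm Γ)} {σ τ} {f g : Tm Γ (σ ⇒ τ)} →
         (Ext x₀ ∷ map wkF H) ⊢ wkT f · x₀ ≐ wkT g · x₀ → H ⊢ f ≐ g
⊢≐-ext d = ⊃E (∧E₂ (ax-=⇒ _ _)) (∀I (⊃I d))

⊢≐-ext′ : ∀ {Γ} {H : List (Fm Γ)} {σ τ} {f g : Tm Γ (σ ⇒ τ)} {f′ g′} → wkT f ≡ f′ → wkT g ≡ g′ →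
          (Ext x₀ ∷ map wkF H) ⊢ f′ · x₀ ≐ g′ · x₀ → H ⊢ f ≐ g
⊢≐-ext′ refl refl = ⊢≐-ext

⊢≐-app : ∀ {Γ} {H : List (Fm Γ)} {σ τ} {f g : Tm Γ (σ ⇒ τ)} {a : Tm Γ σ} →
         H ⊢ f ≐ g → H ⊢ Ext a → H ⊢ f · a ≐ g · a
⊢≐-app {H = H} {f = f} {g} {a} d e =
  ⊃E (subst₂ (λ A B → H ⊢ Ext a ⊃ A · a ≐ B · a) (sub1-wkT a f) (sub1-wkT a g)
             (∀E (⊃E (∧E₁ (ax-=⇒ f g)) d) a)) e

⊢≐-fst : ∀ {Γ} {H : List (Fm Γ)} {σ τ} {a b : Tm Γ (σ ⊗ τ)} → H ⊢ a ≐ b → H ⊢ fst · a ≐ fst · b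
⊢≐-fst d = ∧E₁ (⊃E (∧E₁ (ax-=× _ _)) d)

⊢≐-snd : ∀ {Γ} {H : List (Fm Γ)} {σ τ} {a b : Tm Γ (σ ⊗ τ)} → H ⊢ a ≐ b → H ⊢ snd · a ≐ snd · b
⊢≐-snd d = ∧E₂ (⊃E (∧E₁ (ax-=× _ _)) d)

⊢≐-pair : ∀ {Γ} {H : List (Fm Γ)} {σ τ} {a b : Tm Γ (σ ⊗ τ)} →
          H ⊢ fst · a ≐ fst · b → H ⊢ snd · a ≐ snd · b → H ⊢ a ≐ b
⊢≐-pair d e = ⊃E (∧E₂ (ax-=× _ _)) (∧I d e)

⊢Ext-x₀ : ∀ {Γ σ} {H : List (Fm (σ ∷ Γ))} → (Ext x₀ ∷ H) ⊢ Ext x₀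
⊢Ext-x₀ = hyp (here refl)

≣⇒≐ : ∀ {Γ} {H : List (Fm Γ)} σ {a b : Tm Γ σ} → H ⊢ a ≣ b → H ⊢ a ≐ b
≣⇒≐ ι       d = ⊃E (∧E₂ (ax-=0 _ _)) d
≣⇒≐ (σ ⊗ τ) d = ⊢≐-pair (≣⇒≐ σ (⊢≣-congʳ d)) (≣⇒≐ τ (⊢≣-congʳ d))
≣⇒≐ (σ ⇒ τ) d = ⊢≐-ext (≣⇒≐ τ (⊢≣-congˡ (⊢-wkExt d)))

⊢≐-trans : ∀ {Γ} {H : List (Fm Γ)} σ {a b c : Tm Γ σ} → H ⊢ a ≐ b → H ⊢ b ≐ c → H ⊢ a ≐ c
⊢≐-trans ι       d e = ⊃E (∧E₂ (ax-=0 _ _)) (⊢≣-trans (⊃E (∧E₁ (ax-=0 _ _)) d) (⊃E (∧E₁ (ax-=0 _ _)) e))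
⊢≐-trans (σ ⊗ τ) d e = ⊢≐-pair (⊢≐-trans σ (⊢≐-fst d) (⊢≐-fst e)) (⊢≐-trans τ (⊢≐-snd d) (⊢≐-snd e))
⊢≐-trans (σ ⇒ τ) d e =
  ⊢≐-ext (⊢≐-trans τ (⊢≐-app (⊢-wkExt d) ⊢Ext-x₀) (⊢≐-app (⊢-wkExt e) ⊢Ext-x₀))

⊢≐-resp-≣ : ∀ {Γ} {H : List (Fm Γ)} σ {a a′ b b′ : Tm Γ σ} →
            H ⊢ a ≣ a′ → H ⊢ b ≣ b′ → H ⊢ a′ ≐ b′ → H ⊢ a ≐ b
⊢≐-resp-≣ σ d e a′≐b′ = ⊢≐-trans σ (≣⇒≐ σ d) (⊢≐-trans σ a′≐b′ (≣⇒≐ σ (⊢≣-sym e)))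

⊢Ext-app : ∀ {Γ} {H : List (Fm Γ)} {σ τ} {f : Tm Γ (σ ⇒ τ)} {a : Tm Γ σ} →
           H ⊢ Ext f → H ⊢ Ext a → H ⊢ Ext (f · a)
⊢Ext-app d e = ⊃E (⊃E (ax-Ext⇒ _ _) d) e

⊢Ext-cl : ∀ {Γ} {H : List (Fm Γ)} {σ} (t : Tm [] σ) → H ⊢ Ext (cl t)
⊢Ext-cl (t · u) = ⊢Ext-app (⊢Ext-cl t) (⊢Ext-cl u)
⊢Ext-cl K       = ext-K
⊢Ext-cl S       = ext-S
⊢Ext-cl pair    = ext-pair
⊢Ext-cl fst     = ext-fst
⊢Ext-cl snd     = ext-snd
⊢Ext-cl zero    = ext-0
⊢Ext-cl suc     = ext-suc
⊢Ext-cl R       = ext-R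

⊢Ext-fst : ∀ {Γ} {H : List (Fm Γ)} {σ τ} {a : Tm Γ (σ ⊗ τ)} → H ⊢ Ext a → H ⊢ Ext (fst · a)
⊢Ext-fst = ⊢Ext-app ext-fst

⊢Ext-snd : ∀ {Γ} {H : List (Fm Γ)} {σ τ} {a : Tm Γ (σ ⊗ τ)} → H ⊢ Ext a → H ⊢ Ext (snd · a)
⊢Ext-snd = ⊢Ext-app ext-snd

⊢Ext-pair : ∀ {Γ} {H : List (Fm Γ)} {σ τ} {a : Tm Γ σ} {b : Tm Γ τ} →
            H ⊢ Ext a → H ⊢ Ext b → H ⊢ Ext (pair · a · b)
⊢Ext-pair d e = ⊢Ext-app (⊢Ext-app ext-pair d) e

strong-intro : ∀ {α β} {t : Tm [] (α ⇒ β)} →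
               (∀ {Γ} {H : List (Fm Γ)} {a b : Tm Γ α} →
                  H ⊢ Ext a → H ⊢ Ext b → H ⊢ a ≐ b → H ⊢ cl t · a ≐ cl t · b) →
               Strong t
strong-intro F =
  ∀I (∀I (⊃I (⊃I (⊃I (F (hyp (there (there (here refl)))) (hyp (there (here refl))) (hyp (here refl)))))))

strong-app : ∀ {α β} {t : Tm [] (α ⇒ β)} → Strong t → ∀ {Γ} {H : List (Fm Γ)} {a b : Tm Γ α} →
             H ⊢ Ext a → H ⊢ Ext b → H ⊢ a ≐ b → H ⊢ cl t · a ≐ cl t · b
strong-app {t = t} st {H = H} {a} {b} ea eb a≐b =
  ⊃E (⊃E (⊃E (subst₂ (λ u T → H ⊢ Ext u ⊃ Ext b ⊃ u ≐ b ⊃ T · u ≐ T · b) (sub1-wkT b a) t-closed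
                      (∀E (∀E (⊢-closed st) a) b)) ea) eb) a≐b
  where
  t-closed : subT (sub1 b) (subT (liftS (sub1 a)) (renT (liftR (liftR ren∅)) (cl t))) ≡ cl t
  t-closed = trans (cong (subT (sub1 b)) (subT-renT-cl _ _ t)) (subT-cl _ t)

leftInv-intro : ∀ {α β} {i : Tm [] (α ⇒ β)} {r : Tm [] (β ⇒ α)} →
                (∀ {Γ} {H : List (Fm Γ)} {a : Tm Γ α} → H ⊢ Ext a → H ⊢ cl r · (cl i · a) ≐ a) →
                LeftInv i r
leftInv-intro F = ∀I (⊃I (F (hyp (here refl))))

leftInv-app : ∀ {α β} {i : Tm [] (α ⇒ β)} {r : Tm [] (β ⇒ α)} → LeftInv i r →
              ∀ {Γ} {H : List (Fm Γ)} {a : Tm Γ α} → H ⊢ Ext a → H ⊢ cl r · (cl i · a) ≐ a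
leftInv-app {i = i} {r} li {H = H} {a} ea =
  ⊃E (subst₂ (λ R I → H ⊢ Ext a ⊃ R · (I · a) ≐ a) (subT-renT-cl _ _ r) (subT-renT-cl _ _ i)
             (∀E (⊢-closed li) a)) ea

-- Bracket abstraction

lam : ∀ {Γ σ τ} → Tm (σ ∷ Γ) τ → Tm Γ (σ ⇒ τ)
lam (var here)      = S · K · K {σ = ι}
lam (var (there x)) = K · var x
lam (t · u)         = S · lam t · lam u
lam K               = K · K
lam S               = K · S
lam pair            = K · pair
lam fst             = K · fst
lam snd             = K · snd
lam zero            = K · zero
lam suc             = K · suc
lam R               = K · R

∅ₛ : ∀ {Γ} → Sub [] Γ
∅ₛ ()

infixl 5 _,ₛ_
_,ₛ_ : ∀ {Γ Δ σ} → Sub Γ Δ → Tm Δ σ → Sub (σ ∷ Γ) Δ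
(s ,ₛ a) here      = a
(s ,ₛ a) (there x) = s x

lam-β : ∀ {Γ Δ} {H : List (Fm Δ)} {σ τ} (s : Sub Γ Δ) (t : Tm (σ ∷ Γ) τ) (a : Tm Δ σ) →
        H ⊢ subT s (lam t) · a ≣ subT (s ,ₛ a) t
lam-β s (var here)      a = ⊢≣-trans (ax-S _ _ a) (ax-K a _)
lam-β s (var (there x)) a = ax-K (s x) a
lam-β s (t · u)         a = ⊢≣-trans (ax-S _ _ a) (⊢≣-cong (lam-β s t a) (lam-β s u a))
lam-β s K               a = ax-K _ a
lam-β s S               a = ax-K _ a
lam-β s pair            a = ax-K _ a
lam-β s fst             a = ax-K _ a
lam-β s snd             a = ax-K _ a
lam-β s zero            a = ax-K _ a
lam-β s suc             a = ax-K _ a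
lam-β s R               a = ax-K _ a

lam-β₁ : ∀ {Γ} {H : List (Fm Γ)} {σ τ} (t : Tm (σ ∷ []) τ) (a : Tm Γ σ) →
         H ⊢ cl (lam t) · a ≣ subT (∅ₛ ,ₛ a) t
lam-β₁ {H = H} t a = subst (λ u → H ⊢ u · a ≣ subT (∅ₛ ,ₛ a) t) (sym (cl≡subT ∅ₛ (lam t))) (lam-β ∅ₛ t a)

lam-β₂ : ∀ {Γ} {H : List (Fm Γ)} {σ₁ σ₂ τ} (t : Tm (σ₂ ∷ σ₁ ∷ []) τ) (a : Tm Γ σ₁) (b : Tm Γ σ₂) →
         H ⊢ cl (lam (lam t)) · a · b ≣ subT (∅ₛ ,ₛ a ,ₛ b) t
lam-β₂ t a b = ⊢≣-trans (⊢≣-congˡ (lam-β₁ (lam t) a)) (lam-β (∅ₛ ,ₛ a) t b)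

lam-β₃ : ∀ {Γ} {H : List (Fm Γ)} {σ₁ σ₂ σ₃ τ} (t : Tm (σ₃ ∷ σ₂ ∷ σ₁ ∷ []) τ)
         (a : Tm Γ σ₁) (b : Tm Γ σ₂) (c : Tm Γ σ₃) →
         H ⊢ cl (lam (lam (lam t))) · a · b · c ≣ subT (∅ₛ ,ₛ a ,ₛ b ,ₛ c) t
lam-β₃ t a b c = ⊢≣-trans (⊢≣-congˡ (lam-β₂ (lam t) a b)) (lam-β (∅ₛ ,ₛ a ,ₛ b) t c)

x₂ : ∀ {Γ ρ σ τ} → Tm (ρ ∷ τ ∷ σ ∷ Γ) σ
x₂ = var (there (there here))

x₃ : ∀ {Γ ρ ρ′ σ τ} → Tm (ρ′ ∷ ρ ∷ τ ∷ σ ∷ Γ) σ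
x₃ = var (there (there (there here)))

-- The combinators are used only through their β-laws; unfolding them makes type checking very slow.
opaque
  compose : ∀ {α β γ} → Tm [] ((β ⇒ γ) ⇒ (α ⇒ β) ⇒ α ⇒ γ)
  compose = lam (lam (lam (x₂ · (x₁ · x₀))))

  compose-β : ∀ {Γ} {H : List (Fm Γ)} {α β γ} {g : Tm Γ (β ⇒ γ)} {f : Tm Γ (α ⇒ β)} {a : Tm Γ α} →
              H ⊢ cl compose · g · f · a ≣ g · (f · a)
  compose-β {g = g} {f} {a} = lam-β₃ (x₂ · (x₁ · x₀)) g f a

compose-strong : ∀ {α β γ} {f : Tm [] (α ⇒ β)} {g : Tm [] (β ⇒ γ)} →
                 Strong f → Strong g → Strong (compose · g · f)
compose-strong {γ = γ} {f} sf sg = strong-intro λ ea eb a≐b →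
  ⊢≐-resp-≣ γ compose-β compose-β
    (strong-app sg (⊢Ext-app (⊢Ext-cl f) ea) (⊢Ext-app (⊢Ext-cl f) eb) (strong-app sf ea eb a≐b))

compose-leftInv : ∀ {α β γ} {i₁ : Tm [] (α ⇒ β)} {r₁ : Tm [] (β ⇒ α)}
                  {i₂ : Tm [] (β ⇒ γ)} {r₂ : Tm [] (γ ⇒ β)} →
                  Strong r₁ → LeftInv i₁ r₁ → LeftInv i₂ r₂ → LeftInv (compose · i₂ · i₁) (compose · r₁ · r₂)
compose-leftInv {α} {β} {i₁ = i₁} {r₁} {i₂} {r₂} sr₁ li₁ li₂ = leftInv-intro λ ea →
  let ei₁a = ⊢Ext-app (⊢Ext-cl i₁) ea
  in ⊢≐-trans α (≣⇒≐ α compose-β)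
       (⊢≐-trans α (strong-app sr₁ (⊢Ext-app (⊢Ext-cl r₂) (⊢Ext-app (⊢Ext-cl (compose · i₂ · i₁)) ea)) ei₁a
                                   (⊢≐-resp-≣ β (⊢≣-congʳ compose-β) ⊢≣-refl (leftInv-app li₂ ei₁a)))
                   (leftInv-app li₁ ea))

retract-trans : ∀ α β γ → StrongRetract α β → StrongRetract β γ → StrongRetract α γ
retract-trans α β γ (i₁ , r₁ , si₁ , sr₁ , li₁) (i₂ , r₂ , si₂ , sr₂ , li₂) =
  compose · i₂ · i₁ , compose · r₁ · r₂ , compose-strong si₁ si₂ , compose-strong sr₂ sr₁ ,
  compose-leftInv sr₁ li₁ li₂

postcompose-strong : ∀ {α β γ} {i : Tm [] (α ⇒ β)} → Strong i → Strong (compose {α = γ} · i)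
postcompose-strong {β = β} {i = i} si = strong-intro λ {_} {_} {f} {g} ef eg f≐g →
  ⊢≐-ext′ (wkT-cl-app (compose · i) f) (wkT-cl-app (compose · i) g)
    (⊢≐-resp-≣ β compose-β compose-β
      (strong-app si (⊢Ext-app (⊢-wkExt ef) ⊢Ext-x₀) (⊢Ext-app (⊢-wkExt eg) ⊢Ext-x₀)
                     (⊢≐-app (⊢-wkExt f≐g) ⊢Ext-x₀)))

postcompose-leftInv : ∀ {α β γ} {i : Tm [] (α ⇒ β)} {r : Tm [] (β ⇒ α)} →
                      LeftInv i r → LeftInv (compose {α = γ} · i) (compose · r)
postcompose-leftInv {α} {i = i} {r} li = leftInv-intro λ {_} {_} {f} ef →
  ⊢≐-ext′ (cong₂ _·_ (wkT-cl (compose · r)) (wkT-cl-app (compose · i) f)) refl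
    (⊢≐-resp-≣ α (⊢≣-trans compose-β (⊢≣-congʳ compose-β)) ⊢≣-refl
      (leftInv-app li (⊢Ext-app (⊢-wkExt ef) ⊢Ext-x₀)))

retract-⇒ : ∀ α β γ → StrongRetract α β → StrongRetract (γ ⇒ α) (γ ⇒ β)
retract-⇒ α β γ (i , r , si , sr , li) =
  compose · i , compose · r , postcompose-strong si , postcompose-strong sr , postcompose-leftInv li

iso-⇒ : ∀ α β γ → StrongIso α β → StrongIso (γ ⇒ α) (γ ⇒ β)
iso-⇒ α β γ (i , r , si , sr , li , ri) =
  compose · i , compose · r , postcompose-strong si , postcompose-strong sr ,
  postcompose-leftInv li , postcompose-leftInv ri

opaque
  ⊗-map : ∀ {α₀ α₁ β₀ β₁} → Tm [] ((α₀ ⇒ β₀) ⇒ (α₁ ⇒ β₁) ⇒ α₀ ⊗ α₁ ⇒ β₀ ⊗ β₁)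
  ⊗-map = lam (lam (lam (pair · (x₂ · (fst · x₀)) · (x₁ · (snd · x₀)))))

  ⊗-map-fst : ∀ {Γ} {H : List (Fm Γ)} {α₀ α₁ β₀ β₁} {f : Tm Γ (α₀ ⇒ β₀)} {g : Tm Γ (α₁ ⇒ β₁)} {p} →
              H ⊢ fst · (cl ⊗-map · f · g · p) ≣ f · (fst · p)
  ⊗-map-fst {f = f} {g} {p} =
    ⊢≣-trans (⊢≣-congʳ (lam-β₃ (pair · (x₂ · (fst · x₀)) · (x₁ · (snd · x₀))) f g p)) (ax-fst _ _)

  ⊗-map-snd : ∀ {Γ} {H : List (Fm Γ)} {α₀ α₁ β₀ β₁} {f : Tm Γ (α₀ ⇒ β₀)} {g : Tm Γ (α₁ ⇒ β₁)} {p} →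
              H ⊢ snd · (cl ⊗-map · f · g · p) ≣ g · (snd · p)
  ⊗-map-snd {f = f} {g} {p} =
    ⊢≣-trans (⊢≣-congʳ (lam-β₃ (pair · (x₂ · (fst · x₀)) · (x₁ · (snd · x₀))) f g p)) (ax-snd _ _)

⊗-map-strong : ∀ {α₀ α₁ β₀ β₁} {f : Tm [] (α₀ ⇒ β₀)} {g : Tm [] (α₁ ⇒ β₁)} →
               Strong f → Strong g → Strong (⊗-map · f · g)
⊗-map-strong {β₀ = β₀} {β₁} sf sg = strong-intro λ ea eb a≐b →
  ⊢≐-pair (⊢≐-resp-≣ β₀ ⊗-map-fst ⊗-map-fst (strong-app sf (⊢Ext-fst ea) (⊢Ext-fst eb) (⊢≐-fst a≐b)))
          (⊢≐-resp-≣ β₁ ⊗-map-snd ⊗-map-snd (strong-app sg (⊢Ext-snd ea) (⊢Ext-snd eb) (⊢≐-snd a≐b)))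

⊗-map-leftInv : ∀ {α₀ α₁ β₀ β₁} {i₀ : Tm [] (α₀ ⇒ β₀)} {r₀ : Tm [] (β₀ ⇒ α₀)}
                {i₁ : Tm [] (α₁ ⇒ β₁)} {r₁ : Tm [] (β₁ ⇒ α₁)} →
                LeftInv i₀ r₀ → LeftInv i₁ r₁ → LeftInv (⊗-map · i₀ · i₁) (⊗-map · r₀ · r₁)
⊗-map-leftInv {α₀} {α₁} l₀ l₁ = leftInv-intro λ ea →
  ⊢≐-pair (⊢≐-resp-≣ α₀ (⊢≣-trans ⊗-map-fst (⊢≣-congʳ ⊗-map-fst)) ⊢≣-refl (leftInv-app l₀ (⊢Ext-fst ea)))
          (⊢≐-resp-≣ α₁ (⊢≣-trans ⊗-map-snd (⊢≣-congʳ ⊗-map-snd)) ⊢≣-refl (leftInv-app l₁ (⊢Ext-snd ea)))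

retract-⊗ : ∀ α₀ α₁ β₀ β₁ → StrongRetract α₀ β₀ → StrongRetract α₁ β₁ → StrongRetract (α₀ ⊗ α₁) (β₀ ⊗ β₁)
retract-⊗ α₀ α₁ β₀ β₁ (i₀ , r₀ , si₀ , sr₀ , l₀) (i₁ , r₁ , si₁ , sr₁ , l₁) =
  ⊗-map · i₀ · i₁ , ⊗-map · r₀ · r₁ , ⊗-map-strong si₀ si₁ , ⊗-map-strong sr₀ sr₁ , ⊗-map-leftInv l₀ l₁

opaque
  ⊗-fun : ∀ {α β γ δ} → Tm [] ((α ⇒ β) ⊗ (γ ⇒ δ) ⇒ α ⊗ γ ⇒ β ⊗ δ)
  ⊗-fun = lam (lam (pair · (fst · x₁ · (fst · x₀)) · (snd · x₁ · (snd · x₀))))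

  ⊗-fun-fst : ∀ {Γ} {H : List (Fm Γ)} {α β γ δ} {p : Tm Γ ((α ⇒ β) ⊗ (γ ⇒ δ))} {z : Tm Γ (α ⊗ γ)} →
              H ⊢ fst · (cl ⊗-fun · p · z) ≣ fst · p · (fst · z)
  ⊗-fun-fst {p = p} {z} =
    ⊢≣-trans (⊢≣-congʳ (lam-β₂ (pair · (fst · x₁ · (fst · x₀)) · (snd · x₁ · (snd · x₀))) p z)) (ax-fst _ _)

  ⊗-fun-snd : ∀ {Γ} {H : List (Fm Γ)} {α β γ δ} {p : Tm Γ ((α ⇒ β) ⊗ (γ ⇒ δ))} {z : Tm Γ (α ⊗ γ)} →
              H ⊢ snd · (cl ⊗-fun · p · z) ≣ snd · p · (snd · z)
  ⊗-fun-snd {p = p} {z} =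
    ⊢≣-trans (⊢≣-congʳ (lam-β₂ (pair · (fst · x₁ · (fst · x₀)) · (snd · x₁ · (snd · x₀))) p z)) (ax-snd _ _)

  ⊗-unfun₁ : ∀ {α β γ δ} → Tm (α ∷ (α ⊗ γ ⇒ β ⊗ δ) ∷ γ ∷ α ∷ []) β
  ⊗-unfun₁ = fst · (x₁ · (pair · x₀ · x₂))

  ⊗-unfun₂ : ∀ {α β γ δ} → Tm (γ ∷ (α ⊗ γ ⇒ β ⊗ δ) ∷ γ ∷ α ∷ []) δ
  ⊗-unfun₂ = snd · (x₁ · (pair · x₃ · x₀))

  ⊗-unfunAt : ∀ {α β γ δ} → Tm [] (α ⇒ γ ⇒ (α ⊗ γ ⇒ β ⊗ δ) ⇒ (α ⇒ β) ⊗ (γ ⇒ δ))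
  ⊗-unfunAt = lam (lam (lam (pair · lam ⊗-unfun₁ · lam ⊗-unfun₂)))

  ⊗-unfunAt-fst : ∀ {Γ} {H : List (Fm Γ)} {α β γ δ} {a₀ : Tm Γ α} {c₀ : Tm Γ γ}
                  {h : Tm Γ (α ⊗ γ ⇒ β ⊗ δ)} {a : Tm Γ α} →
                  H ⊢ fst · (cl ⊗-unfunAt · a₀ · c₀ · h) · a ≣ fst · (h · (pair · a · c₀))
  ⊗-unfunAt-fst {a₀ = a₀} {c₀} {h} {a} =
    ⊢≣-trans (⊢≣-congˡ (⊢≣-trans (⊢≣-congʳ (lam-β₃ (pair · lam ⊗-unfun₁ · lam ⊗-unfun₂) a₀ c₀ h))
                                  (ax-fst _ _)))
             (lam-β (∅ₛ ,ₛ a₀ ,ₛ c₀ ,ₛ h) ⊗-unfun₁ a)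

  ⊗-unfunAt-snd : ∀ {Γ} {H : List (Fm Γ)} {α β γ δ} {a₀ : Tm Γ α} {c₀ : Tm Γ γ}
                  {h : Tm Γ (α ⊗ γ ⇒ β ⊗ δ)} {c : Tm Γ γ} →
                  H ⊢ snd · (cl ⊗-unfunAt · a₀ · c₀ · h) · c ≣ snd · (h · (pair · a₀ · c))
  ⊗-unfunAt-snd {a₀ = a₀} {c₀} {h} {c} =
    ⊢≣-trans (⊢≣-congˡ (⊢≣-trans (⊢≣-congʳ (lam-β₃ (pair · lam ⊗-unfun₁ · lam ⊗-unfun₂) a₀ c₀ h))
                                  (ax-snd _ _)))
             (lam-β (∅ₛ ,ₛ a₀ ,ₛ c₀ ,ₛ h) ⊗-unfun₂ c)

⊗-fun-strong : ∀ {α β γ δ} → Strong (⊗-fun {α} {β} {γ} {δ})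
⊗-fun-strong {β = β} {δ = δ} = strong-intro λ {_} {_} {p} {q} ep eq p≐q →
  ⊢≐-ext′ (wkT-cl-app ⊗-fun p) (wkT-cl-app ⊗-fun q)
    (⊢≐-pair (⊢≐-resp-≣ β ⊗-fun-fst ⊗-fun-fst (⊢≐-app (⊢≐-fst (⊢-wkExt p≐q)) (⊢Ext-fst ⊢Ext-x₀)))
             (⊢≐-resp-≣ δ ⊗-fun-snd ⊗-fun-snd (⊢≐-app (⊢≐-snd (⊢-wkExt p≐q)) (⊢Ext-snd ⊢Ext-x₀))))

⊗-unfunAt-strong : ∀ {α β γ δ} (a₀ : Tm [] α) (c₀ : Tm [] γ) → Strong (⊗-unfunAt {β = β} {δ = δ} · a₀ · c₀)
⊗-unfunAt-strong {α} {β} {γ} {δ} a₀ c₀ = strong-intro λ {_} {_} {h} {k} eh ek h≐k →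
  ⊢≐-pair
    (⊢≐-ext′ (cong (fst ·_) (wkT-cl-app u h)) (cong (fst ·_) (wkT-cl-app u k))
      (⊢≐-resp-≣ β ⊗-unfunAt-fst ⊗-unfunAt-fst
        (⊢≐-fst (⊢≐-app (⊢-wkExt h≐k) (⊢Ext-pair ⊢Ext-x₀ (⊢Ext-cl c₀))))))
    (⊢≐-ext′ (cong (snd ·_) (wkT-cl-app u h)) (cong (snd ·_) (wkT-cl-app u k))
      (⊢≐-resp-≣ δ ⊗-unfunAt-snd ⊗-unfunAt-snd
        (⊢≐-snd (⊢≐-app (⊢-wkExt h≐k) (⊢Ext-pair (⊢Ext-cl a₀) ⊢Ext-x₀)))))
  where
  u : Tm [] ((α ⊗ γ ⇒ β ⊗ δ) ⇒ (α ⇒ β) ⊗ (γ ⇒ δ))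
  u = ⊗-unfunAt · a₀ · c₀

⊗-fun-leftInv : ∀ {α β γ δ} (a₀ : Tm [] α) (c₀ : Tm [] γ) →
                LeftInv (⊗-fun {β = β} {δ = δ}) (⊗-unfunAt · a₀ · c₀)
⊗-fun-leftInv {α} {β} {γ} {δ} a₀ c₀ = leftInv-intro λ {_} {_} {p} ep →
  ⊢≐-pair
    (⊢≐-ext′ (cong (fst ·_) unfun-fun-wkT) refl
      (≣⇒≐ β (⊢≣-trans ⊗-unfunAt-fst (⊢≣-trans ⊗-fun-fst (⊢≣-congʳ (ax-fst _ _))))))
    (⊢≐-ext′ (cong (snd ·_) unfun-fun-wkT) refl
      (≣⇒≐ δ (⊢≣-trans ⊗-unfunAt-snd (⊢≣-trans ⊗-fun-snd (⊢≣-congʳ (ax-snd _ _))))))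
  where
  unfun-fun-wkT : ∀ {Γ τ} {p : Tm Γ ((α ⇒ β) ⊗ (γ ⇒ δ))} →
                  wkT {τ = τ} (cl (⊗-unfunAt · a₀ · c₀) · (cl ⊗-fun · p))
                  ≡ cl (⊗-unfunAt · a₀ · c₀) · (cl ⊗-fun · wkT p)
  unfun-fun-wkT {p = p} = cong₂ _·_ (wkT-cl (⊗-unfunAt · a₀ · c₀)) (wkT-cl-app ⊗-fun p)

inhabitant : (σ : Ty) → Tm [] σ
inhabitant ι       = zero
inhabitant (σ ⊗ τ) = pair · inhabitant σ · inhabitant τ
inhabitant (σ ⇒ τ) = K · inhabitant τ

retract-⊗⇒ : ∀ α β γ δ → StrongRetract ((α ⇒ β) ⊗ (γ ⇒ δ)) (α ⊗ γ ⇒ β ⊗ δ)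
retract-⊗⇒ α β γ δ =
  ⊗-fun , ⊗-unfunAt · inhabitant α · inhabitant γ , ⊗-fun-strong ,
  ⊗-unfunAt-strong (inhabitant α) (inhabitant γ) , ⊗-fun-leftInv (inhabitant α) (inhabitant γ)

opaque
  uncurry : ∀ {α β γ} → Tm [] ((α ⇒ β ⇒ γ) ⇒ α ⊗ β ⇒ γ)
  uncurry = lam (lam (x₁ · (fst · x₀) · (snd · x₀)))

  uncurry-β : ∀ {Γ} {H : List (Fm Γ)} {α β γ} {f : Tm Γ (α ⇒ β ⇒ γ)} {p : Tm Γ (α ⊗ β)} →
              H ⊢ cl uncurry · f · p ≣ f · (fst · p) · (snd · p)
  uncurry-β {f = f} {p} = lam-β₂ (x₁ · (fst · x₀) · (snd · x₀)) f p

  curry : ∀ {α β γ} → Tm [] ((α ⊗ β ⇒ γ) ⇒ α ⇒ β ⇒ γ)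
  curry = lam (lam (lam (x₂ · (pair · x₁ · x₀))))

  curry-β : ∀ {Γ} {H : List (Fm Γ)} {α β γ} {h : Tm Γ (α ⊗ β ⇒ γ)} {a : Tm Γ α} {b : Tm Γ β} →
            H ⊢ cl curry · h · a · b ≣ h · (pair · a · b)
  curry-β {h = h} {a} {b} = lam-β₃ (x₂ · (pair · x₁ · x₀)) h a b

uncurry-strong : ∀ {α β γ} → Strong (uncurry {α} {β} {γ})
uncurry-strong {γ = γ} = strong-intro λ {_} {_} {f} {g} ef eg f≐g →
  ⊢≐-ext′ (wkT-cl-app uncurry f) (wkT-cl-app uncurry g)
    (⊢≐-resp-≣ γ uncurry-β uncurry-β (⊢≐-app (⊢≐-app (⊢-wkExt f≐g) (⊢Ext-fst ⊢Ext-x₀)) (⊢Ext-snd ⊢Ext-x₀)))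

curry-strong : ∀ {α β γ} → Strong (curry {α} {β} {γ})
curry-strong {γ = γ} = strong-intro λ {_} {_} {h} {k} eh ek h≐k →
  ⊢≐-ext′ (wkT-cl-app curry h) (wkT-cl-app curry k)
    (⊢≐-ext′ (cong (_· x₁) (wkT-cl-app curry (wkT h))) (cong (_· x₁) (wkT-cl-app curry (wkT k)))
      (⊢≐-resp-≣ γ curry-β curry-β
        (⊢≐-app (⊢-wkExt (⊢-wkExt h≐k)) (⊢Ext-pair (hyp (there (here refl))) ⊢Ext-x₀))))

uncurry-leftInv : ∀ {α β γ} → LeftInv (uncurry {α} {β} {γ}) curry
uncurry-leftInv {γ = γ} = leftInv-intro λ {_} {_} {f} ef →
  ⊢≐-ext′ (cong₂ _·_ (wkT-cl curry) (wkT-cl-app uncurry f)) refl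
    (⊢≐-ext′ (cong₂ (λ c u → c · (u · wkT (wkT f)) · x₁) (wkT-cl curry) (wkT-cl uncurry)) refl
      (≣⇒≐ γ (⊢≣-trans curry-β (⊢≣-trans uncurry-β (⊢≣-cong (⊢≣-congʳ (ax-fst _ _)) (ax-snd _ _))))))

retract-curry : ∀ α β γ → StrongRetract (α ⇒ β ⇒ γ) (α ⊗ β ⇒ γ)
retract-curry α β γ = uncurry , curry , uncurry-strong , curry-strong , uncurry-leftInv

lemma3p4 :
    (∀ α β γ → StrongRetract α β → StrongRetract β γ → StrongRetract α γ)
    × (∀ α₀ α₁ β₀ β₁ → StrongRetract α₀ β₀ → StrongRetract α₁ β₁ →
         StrongRetract (α₀ ⊗ α₁) (β₀ ⊗ β₁))
    × (∀ α β γ → StrongRetract α β → StrongRetract (γ ⇒ α) (γ ⇒ β))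
    × (∀ α β γ → StrongIso α β → StrongIso (γ ⇒ α) (γ ⇒ β))
    × (∀ α β γ δ → StrongRetract ((α ⇒ β) ⊗ (γ ⇒ δ)) (α ⊗ γ ⇒ β ⊗ δ))
    × (∀ α β γ → StrongRetract (α ⇒ β ⇒ γ) (α ⊗ β ⇒ γ))
lemma3p4 = retract-trans , retract-⊗ , retract-⇒ , iso-⇒ , retract-⊗⇒ , retract-curry
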